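{- The exponential generating function of flattened permutations without valleys, $\sum_{n\ge0}\frac{x^n}{n!}\left|\{\pi\in\mathcal F_n:\mathrm{val}(\pi)=0\}\right|$, equals $2+x+(x-1)e^x$. Consequently, the number of flattened permutations of length $n$ without valleys is $n-1$ for $n\ge2$.
   Context: A permutation of $[n]$ is written $\pi=\pi_1\cdots\pi_n$; the empty permutation is included for $n=0$. A run is a maximal block of consecutive increasing entries. A permutation is flattened if the first entries of its runs, read from left to right, are increasing; $\mathcal F_n$ is the set of flattened permutations of length $n$. A valley is an index $\ell$ with $2\le\ell\le n-1$ and $\pi_{\ell-1}>\pi_\ell<\pi_{\ell+1}$; $\mathrm{val}(\pi)$ is the number of valleys. -}

module Defs where

open import Data.Bool using (Bool; true; false; if_then_else_; _∧_; not)
open import Data.Nat using (ℕ; zero; suc; _<ᵇ_; _≡ᵇ_; _+_; _∸_; _!)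
open import Data.Nat.Properties using (_!≢0)
open import Data.List using (List; []; _∷_; map; concatMap; length; filterᵇ; upTo; sum; foldr)
open import Data.Integer using (ℤ; +_)
open import Data.Rational as ℚ using (ℚ; 0ℚ; 1ℚ; _/_)

-- Permutations of [n] = {1,…,n}, as lists of values (one-line notation π₁⋯πₙ).

words : ℕ → ℕ → List (List ℕ)
words zero    n = [] ∷ []
words (suc k) n = concatMap (λ w → map (λ a → suc a ∷ w) (upTo n)) (words k n)

elemᵇ : ℕ → List ℕ → Bool
elemᵇ x []       = false
elemᵇ x (y ∷ ys) = if x ≡ᵇ y then true else elemᵇ x ys

distinctᵇ : List ℕ → Bool
distinctᵇ []       = true
distinctᵇ (x ∷ xs) = not (elemᵇ x xs) ∧ distinctᵇ xs

perms : ℕ → List (List ℕ)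
perms n = filterᵇ distinctᵇ (words n n)

runs : List ℕ → List (List ℕ)
runs []           = []
runs (x ∷ [])     = (x ∷ []) ∷ []
runs (x ∷ y ∷ zs) with runs (y ∷ zs)
... | []     = (x ∷ []) ∷ []   -- unreachable: runs of a nonempty word is nonempty
... | r ∷ rs = if x <ᵇ y then (x ∷ r) ∷ rs else (x ∷ []) ∷ r ∷ rs

firsts : List (List ℕ) → List ℕ
firsts []             = []
firsts ([] ∷ bs)      = firsts bs
firsts ((x ∷ _) ∷ bs) = x ∷ firsts bs

increasingᵇ : List ℕ → Bool
increasingᵇ []           = true
increasingᵇ (x ∷ [])     = true
increasingᵇ (x ∷ y ∷ zs) = (x <ᵇ y) ∧ increasingᵇ (y ∷ zs)

flattenedᵇ : List ℕ → Bool
flattenedᵇ π = increasingᵇ (firsts (runs π))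

val : List ℕ → ℕ
val (x ∷ y ∷ z ∷ zs) = (if (y <ᵇ x) ∧ (y <ᵇ z) then 1 else 0) + val (y ∷ z ∷ zs)
val _                = 0

flatNoValley : ℕ → ℕ
flatNoValley n = length (filterᵇ (λ π → flattenedᵇ π ∧ (val π ≡ᵇ 0)) (perms n))

Series : Set
Series = ℕ → ℚ

_⊕_ : Series → Series → Series
(f ⊕ g) n = f n ℚ.+ g n

_⊛_ : Series → Series → Series
(f ⊛ g) n = foldr ℚ._+_ 0ℚ (map (λ k → f k ℚ.* g (n ∸ k)) (upTo (suc n)))

const : ℚ → Series
const c zero    = c
const c (suc _) = 0ℚ

X : Series
X 1 = 1ℚ
X _ = 0ℚ

expS : Series
expS n = (+ 1) / (n !) where instance _ = n !≢0

egf : (ℕ → ℕ) → Series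
egf a n = (+ a n) / (n !) where instance _ = n !≢0

{-# OPTIONS --safe #-}
module Submission where

-- A valley-free permutation rises to its maximum and then falls, and every entry after the
-- maximum starts a new run.  Flattened means the run heads increase, while the entries after
-- the maximum decrease; so at most one entry follows the maximum, and it exceeds the first
-- entry.  Thus π is a hook: an increasing word followed by one entry u above its first entry.
-- For a permutation of [n] this forces π = 1 ⋯ (u−1) (u+1) ⋯ n u with 2 ≤ u ≤ n (u = n is the
-- identity), so there are n − 1 of them, and (n − 1)/n! = 1/(n − 1)! − 1/n! is the coefficient
-- of xⁿ in (x − 1)eˣ.

open import Defs
open import Data.Nat using (ℕ; _≤_; _∸_)
open import Data.Integer using (+_)
open import Data.Rational using (ℚ; _/_; 1ℚ; -_)
open import Data.Product using (_×_)
open import Relation.Binary.PropositionalEquality using (_≡_)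

open import Data.Bool using (Bool; true; false; T; not; _∧_)
open import Data.Bool.Properties using (T-∧; T-≡)
open import Data.Empty using (⊥-elim)
import Data.Integer as ℤ
open import Data.Integer.Tactic.RingSolver using (solve-∀)
open import Data.List
  using (List; []; _∷_; _++_; _∷ʳ_; [_]; length; map; drop; foldr; applyUpTo; upTo; filterᵇ; concatMap; cartesianProductWith)
open import Data.List.Membership.Propositional using (_∈_)
open import Data.List.Membership.Propositional.Properties
  using (∈-cartesianProductWith⁺; ∈-cartesianProductWith⁻; ∈-upTo⁺; ∈-upTo⁻; ∈-filter⁺; ∈-filter⁻; ∈-map⁺; ∈-map⁻)
open import Data.List.Membership.Propositional.Properties.WithK using (unique∧set⇒bag)
open import Data.List.Properties using (length-map; length-++; ∷ʳ-injectiveʳ)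
open import Data.List.Relation.Binary.BagAndSetEquality using (∼bag⇒↭)
open import Data.List.Relation.Binary.Permutation.Propositional.Properties using (↭-length)
open import Data.List.Relation.Unary.All as All using (All; []; _∷_)
import Data.List.Relation.Unary.All.Properties as AllP
open import Data.List.Relation.Unary.AllPairs as AllPairs using ([]; _∷_)
open import Data.List.Relation.Unary.Any using (here; there)
open import Data.List.Relation.Unary.Linked as Linked using (Linked; []; [-]; _∷_)
import Data.List.Relation.Unary.Linked.Properties as LinkedP
open import Data.List.Relation.Unary.Unique.Propositional using (Unique)
import Data.List.Relation.Unary.Unique.Propositional.Properties as UniqueP
open import Data.Nat using (zero; suc; _+_; _*_; _<_; _<ᵇ_; _≡ᵇ_; _!; NonZero; z≤n; s≤s)
open import Data.Nat.Properties
open import Data.Product using (∃; ∃₂; _,_; proj₁; proj₂)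
import Data.Rational.Properties as ℚ
open import Data.Rational as ℚ using (0ℚ; toℚᵘ)
open import Data.Rational.Unnormalised as ℚᵘ using (mkℚᵘ; *≡*)
import Data.Rational.Unnormalised.Properties as ℚᵘ
open import Algebra.Properties.Ring ℚ.+-*-ring using (-1*x≈-x)
open import Data.Sum as Sum using (_⊎_; inj₁; inj₂)
open import Function using (_∘_; _⇔_; mk⇔; Equivalence)
open import Relation.Binary using (tri<; tri≈; tri>)
open import Relation.Binary.PropositionalEquality using (refl; sym; trans; cong; cong₂; subst; _≢_; module ≡-Reasoning)
open import Relation.Nullary using (¬_; yes; no)
open import Relation.Nullary.Decidable using (T?)

open Equivalence using (to; from)

Increasing : List ℕ → Set
Increasing = Linked _<_

Increasing⇒Unique : ∀ {xs} → Increasing xs → Unique xs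
Increasing⇒Unique = AllPairs.map <⇒≢ ∘ LinkedP.Linked⇒AllPairs <-trans

head<tail : ∀ {x xs} → Increasing (x ∷ xs) → All (x <_) xs
head<tail [-]        = []
head<tail (x<y ∷ lk) = LinkedP.Linked⇒All <-trans x<y lk

Increasing-++⁺ : ∀ {xs ys} m → Increasing xs → Increasing ys → All (_< m) xs → All (m <_) ys →
  Increasing (xs ++ ys)
Increasing-++⁺ m []          lys _            _          = lys
Increasing-++⁺ m [-]         []  _            _          = [-]
Increasing-++⁺ m [-]         lys (x<m ∷ [])   (m<y ∷ _)  = <-trans x<m m<y ∷ lys
Increasing-++⁺ m (x<y ∷ lxs) lys (_ ∷ xs<m)   ys>m       = x<y ∷ Increasing-++⁺ m lxs lys xs<m ys>m

Increasing-++⁻ˡ : ∀ xs {ys} → Increasing (xs ++ ys) → Increasing xs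
Increasing-++⁻ˡ []           _          = []
Increasing-++⁻ˡ (x ∷ [])     _          = [-]
Increasing-++⁻ˡ (x ∷ y ∷ xs) (x<y ∷ lk) = x<y ∷ Increasing-++⁻ˡ (y ∷ xs) lk

Increasing-++⁻ʳ : ∀ xs {ys} → Increasing (xs ++ ys) → Increasing ys
Increasing-++⁻ʳ []       lk = lk
Increasing-++⁻ʳ (x ∷ xs) lk = Increasing-++⁻ʳ xs (Linked.tail lk)

increasing-split : ∀ {xs} u → Increasing xs → All (_≢ u) xs →
  ∃₂ λ ys zs → xs ≡ ys ++ zs × All (_< u) ys × All (u <_) zs
increasing-split u []          [] = [] , [] , refl , [] , []
increasing-split {x ∷ xs} u lk (x≢u ∷ xs≢u) with <-cmp x u
... | tri< x<u _ _ = let ys , zs , eq , ys<u , u<zs = increasing-split u (Linked.tail lk) xs≢u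
                     in x ∷ ys , zs , cong (x ∷_) eq , x<u ∷ ys<u , u<zs
... | tri≈ _ x≡u _ = ⊥-elim (x≢u x≡u)
... | tri> _ _ u<x = [] , x ∷ xs , refl , [] , u<x ∷ All.map (<-trans u<x) (head<tail lk)

range : ℕ → ℕ → List ℕ
range a zero    = []
range a (suc k) = a ∷ range (suc a) k

length-range : ∀ a k → length (range a k) ≡ k
length-range a zero    = refl
length-range a (suc k) = cong suc (length-range (suc a) k)

range-increasing : ∀ a k → Increasing (range a k)
range-increasing a zero          = []
range-increasing a (suc zero)    = [-]
range-increasing a (suc (suc k)) = n<1+n a ∷ range-increasing (suc a) (suc k)

range-bounds : ∀ a k → All (λ v → a ≤ v × v < a + k) (range a k)
range-bounds a zero    = []
range-bounds a (suc k) = (≤-refl , a<a+[1+k]) ∷ All.map widen (range-bounds (suc a) k)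
  where
  a+[1+k]≡ : suc (a + k) ≡ a + suc k
  a+[1+k]≡ = sym (+-suc a k)
  a<a+[1+k] : a < a + suc k
  a<a+[1+k] = subst (a <_) a+[1+k]≡ (s≤s (m≤m+n a k))
  widen : ∀ {v} → suc a ≤ v × v < suc a + k → a ≤ v × v < a + suc k
  widen {v} (a<v , v<) = <⇒≤ a<v , subst (v <_) a+[1+k]≡ v<

∈-range⁺ : ∀ {a k v} → a ≤ v → v < a + k → v ∈ range a k
∈-range⁺ {a} {zero}  {v} a≤v v<a+0 = ⊥-elim (<⇒≱ (subst (v <_) (+-identityʳ a) v<a+0) a≤v)
∈-range⁺ {a} {suc k} {v} a≤v v<a+k with m≤n⇒m<n∨m≡n a≤v
... | inj₁ a<v  = there (∈-range⁺ a<v (subst (v <_) (+-suc a k) v<a+k))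
... | inj₂ refl = here refl

increasing⇒length≤ : ∀ {xs c d} → Increasing xs → All (c ≤_) xs → All (_< d) xs → length xs ≤ d ∸ c
increasing⇒length≤ []                 _           _           = z≤n
increasing⇒length≤ {x ∷ xs} {c} {d} lk (c≤x ∷ _) (x<d ∷ xs<d) = begin-strict
  length xs     ≤⟨ increasing⇒length≤ (Linked.tail lk) (head<tail lk) xs<d ⟩
  d ∸ suc x     <⟨ ∸-monoʳ-< (s≤s c≤x) x<d ⟩
  d ∸ c         ∎
  where open ≤-Reasoning

increasing⇒≡range : ∀ {xs c d} → Increasing xs → All (c ≤_) xs → All (_< d) xs → length xs ≡ d ∸ c →
  xs ≡ range c (d ∸ c)
increasing⇒≡range {[]}     {c}         _  _           _            len = cong (range c) len
increasing⇒≡range {x ∷ xs} {c} {zero}  _  _           (() ∷ _)     _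
increasing⇒≡range {x ∷ xs} {c} {suc d} lk (c≤x ∷ c≤xs) (x<d ∷ xs<d) len with m≤n⇒m<n∨m≡n c≤x
... | inj₁ c<x  = ⊥-elim (<-irrefl len (begin-strict
  length (x ∷ xs)  ≤⟨ increasing⇒length≤ lk (c<x ∷ All.map (<-trans c<x) (head<tail lk)) (x<d ∷ xs<d) ⟩
  suc d ∸ suc c    <⟨ ∸-monoʳ-< (n<1+n c) (≤-trans c<x (<⇒≤ x<d)) ⟩
  suc d ∸ c        ∎))
  where open ≤-Reasoning
... | inj₂ refl rewrite +-∸-assoc 1 (≤-pred x<d) =
  cong (x ∷_) (increasing⇒≡range (Linked.tail lk) (head<tail lk) xs<d (suc-injective len))

≤∧≤∧+≡⇒≡∧≡ : ∀ {a b p q} → a ≤ p → b ≤ q → a + b ≡ p + q → a ≡ p × b ≡ q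
≤∧≤∧+≡⇒≡∧≡ {a} {b} {p} {q} a≤p b≤q eq = a≡p , +-cancelˡ-≡ p b q (subst (λ t → t + b ≡ p + q) a≡p eq)
  where
  a≡p : a ≡ p
  a≡p = ≤-antisym a≤p (+-cancelʳ-≤ q p a (≤-trans (≤-reflexive (sym eq)) (+-monoʳ-≤ a b≤q)))

[u∸1]+[n∸u]≡n∸1 : ∀ {u n} → 1 ≤ u → u ≤ n → (u ∸ 1) + (n ∸ u) ≡ n ∸ 1
[u∸1]+[n∸u]≡n∸1 (s≤s z≤n) (s≤s u≤n) = m+[n∸m]≡n u≤n

Letter : ℕ → ℕ → Set
Letter n a = 1 ≤ a × a ≤ n

rangeWithout : ℕ → ℕ → List ℕ
rangeWithout n u = range 1 (u ∸ 1) ++ range (suc u) (n ∸ u)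

module _ {n u : ℕ} (1≤u : 1 ≤ u) (u≤n : u ≤ n) where

  private
    below : All (λ v → 1 ≤ v × v < u) (range 1 (u ∸ 1))
    below = All.map (λ {v} (1≤v , v<) → 1≤v , subst (v <_) (m+[n∸m]≡n 1≤u) v<) (range-bounds 1 (u ∸ 1))

    above : All (λ v → u < v × v < suc n) (range (suc u) (n ∸ u))
    above = All.map (λ {v} (u<v , v<) → u<v , subst (v <_) (cong suc (m+[n∸m]≡n u≤n)) v<) (range-bounds (suc u) (n ∸ u))

  rangeWithout-increasing : Increasing (rangeWithout n u)
  rangeWithout-increasing =
    Increasing-++⁺ u (range-increasing 1 (u ∸ 1)) (range-increasing (suc u) (n ∸ u)) (All.map proj₂ below) (All.map proj₁ above)

  rangeWithout-letters : All (Letter n) (rangeWithout n u)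
  rangeWithout-letters = AllP.++⁺
    (All.map (λ (1≤v , v<u) → 1≤v , ≤-trans (<⇒≤ v<u) u≤n) below)
    (All.map (λ (u<v , v<1+n) → ≤-trans (s≤s z≤n) u<v , ≤-pred v<1+n) above)

  rangeWithout-avoids : All (_≢ u) (rangeWithout n u)
  rangeWithout-avoids = AllP.++⁺ (All.map (<⇒≢ ∘ proj₂) below) (All.map (>⇒≢ ∘ proj₁) above)

  length-rangeWithout : length (rangeWithout n u) ≡ n ∸ 1
  length-rangeWithout = begin
    length (rangeWithout n u)
      ≡⟨ length-++ (range 1 (u ∸ 1)) ⟩
    length (range 1 (u ∸ 1)) + length (range (suc u) (n ∸ u))
      ≡⟨ cong₂ _+_ (length-range 1 (u ∸ 1)) (length-range (suc u) (n ∸ u)) ⟩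
    (u ∸ 1) + (n ∸ u)
      ≡⟨ [u∸1]+[n∸u]≡n∸1 1≤u u≤n ⟩
    n ∸ 1 ∎
    where open ≡-Reasoning

  increasing⇒≡rangeWithout : ∀ {xs} → Increasing xs → All (Letter n) xs → All (_≢ u) xs → length xs ≡ n ∸ 1 →
    xs ≡ rangeWithout n u
  increasing⇒≡rangeWithout lk letters avoids len with increasing-split u lk avoids
  ... | ys , zs , refl , ys<u , u<zs = cong₂ _++_
    (increasing⇒≡range lkys ys≥1 ys<u (proj₁ lengths))
    (increasing⇒≡range lkzs u<zs zs≤n (proj₂ lengths))
    where
    lkys : Increasing ys
    lkys = Increasing-++⁻ˡ ys lk
    lkzs : Increasing zs
    lkzs = Increasing-++⁻ʳ ys lk
    ys≥1 : All (1 ≤_) ys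
    ys≥1 = All.map proj₁ (AllP.++⁻ˡ ys letters)
    zs≤n : All (_< suc n) zs
    zs≤n = All.map (s≤s ∘ proj₂) (AllP.++⁻ʳ ys letters)
    lengths : length ys ≡ u ∸ 1 × length zs ≡ n ∸ u
    lengths = ≤∧≤∧+≡⇒≡∧≡ (increasing⇒length≤ lkys ys≥1 ys<u) (increasing⇒length≤ lkzs u<zs zs≤n)
      (trans (sym (length-++ ys)) (trans len (sym ([u∸1]+[n∸u]≡n∸1 1≤u u≤n))))

unique∧set⇒length≡ : ∀ {A : Set} {xs ys : List A} → Unique xs → Unique ys →
  (∀ {z} → z ∈ xs ⇔ z ∈ ys) → length xs ≡ length ys
unique∧set⇒length≡ uxs uys xs≈ys = ↭-length (∼bag⇒↭ (unique∧set⇒bag uxs uys xs≈ys))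

Unique-∷ʳ⁻ : ∀ (xs : List ℕ) {u} → Unique (xs ∷ʳ u) → All (_≢ u) xs
Unique-∷ʳ⁻ []       _             = []
Unique-∷ʳ⁻ (x ∷ xs) (x∉ ∷ unique) = proj₂ (AllP.∷ʳ⁻ {xs = xs} x∉) ∷ Unique-∷ʳ⁻ xs unique

Unique-∷ʳ⁺ : ∀ {xs : List ℕ} {u} → Unique xs → All (_≢ u) xs → Unique (xs ∷ʳ u)
Unique-∷ʳ⁺ unique avoids = UniqueP.++⁺ unique ([] ∷ []) λ { (v∈ , here refl) → All.lookup avoids v∈ refl }

<ᵇ-true : ∀ {x y} → x < y → (x <ᵇ y) ≡ true
<ᵇ-true x<y = to T-≡ (<⇒<ᵇ x<y)

<ᵇ-false : ∀ {x y} → ¬ x < y → (x <ᵇ y) ≡ false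
<ᵇ-false {x} {y} x≮y with x <ᵇ y in eq
... | true  = ⊥-elim (x≮y (<ᵇ⇒< x y (subst T (sym eq) _)))
... | false = refl

T-not-elemᵇ : ∀ x xs → T (not (elemᵇ x xs)) ⇔ All (x ≢_) xs
T-not-elemᵇ x []       = mk⇔ (λ _ → []) (λ _ → _)
T-not-elemᵇ x (y ∷ ys) with x ≡ᵇ y in eq
... | true  = mk⇔ (λ ()) (λ { (x≢y ∷ _) → x≢y (≡ᵇ⇒≡ x y (subst T (sym eq) _)) })
... | false = mk⇔ (λ t → x≢y ∷ to ih t) (λ { (_ ∷ ne) → from ih ne })
  where
  ih : T (not (elemᵇ x ys)) ⇔ All (x ≢_) ys
  ih = T-not-elemᵇ x ys
  x≢y : x ≢ y
  x≢y x≡y = subst T eq (≡⇒≡ᵇ x y x≡y)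

T-distinctᵇ : ∀ xs → T (distinctᵇ xs) ⇔ Unique xs
T-distinctᵇ []       = mk⇔ (λ _ → []) (λ _ → _)
T-distinctᵇ (x ∷ xs) = let ih = T-distinctᵇ xs in mk⇔
  (λ t → let x∉ , rest = to T-∧ t in to (T-not-elemᵇ x xs) x∉ ∷ to ih rest)
  (λ { (x∉ ∷ rest) → from T-∧ (from (T-not-elemᵇ x xs) x∉ , from ih rest) })

T-increasingᵇ : ∀ xs → T (increasingᵇ xs) ⇔ Increasing xs
T-increasingᵇ []           = mk⇔ (λ _ → []) (λ _ → _)
T-increasingᵇ (x ∷ [])     = mk⇔ (λ _ → [-]) (λ _ → _)
T-increasingᵇ (x ∷ y ∷ zs) = let ih = T-increasingᵇ (y ∷ zs) in mk⇔
  (λ t → let x<y , rest = to T-∧ t in <ᵇ⇒< x y x<y ∷ to ih rest)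
  (λ lk → from T-∧ (<⇒<ᵇ (Linked.head lk) , from ih (Linked.tail lk)))

concatMap-map≡cartesianProductWith : ∀ {A B C : Set} (f : A → B → C) xs ys →
  concatMap (λ x → map (f x) ys) xs ≡ cartesianProductWith f xs ys
concatMap-map≡cartesianProductWith f []       ys = refl
concatMap-map≡cartesianProductWith f (x ∷ xs) ys =
  cong (map (f x) ys ++_) (concatMap-map≡cartesianProductWith f xs ys)

prependLetter : List ℕ → ℕ → List ℕ
prependLetter w a = suc a ∷ w

words-suc : ∀ k n → words (suc k) n ≡ cartesianProductWith prependLetter (words k n) (upTo n)
words-suc k n = concatMap-map≡cartesianProductWith prependLetter (words k n) (upTo n)

∈-words⁻ : ∀ k n {w} → w ∈ words k n → length w ≡ k × All (Letter n) w
∈-words⁻ zero    n (here refl) = refl , []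
∈-words⁻ (suc k) n w∈
  with w , a , w∈ , a∈ , refl ← ∈-cartesianProductWith⁻ prependLetter (words k n) (upTo n) (subst (_ ∈_) (words-suc k n) w∈)
  = let len , letters = ∈-words⁻ k n w∈ in cong suc len , (s≤s z≤n , ∈-upTo⁻ a∈) ∷ letters

∈-words⁺ : ∀ k n w → length w ≡ k → All (Letter n) w → w ∈ words k n
∈-words⁺ zero    n []          refl []                          = here refl
∈-words⁺ (suc k) n (suc a ∷ w) refl ((s≤s z≤n , a<n) ∷ letters) = subst (_ ∈_) (sym (words-suc k n))
  (∈-cartesianProductWith⁺ prependLetter (∈-words⁺ k n w refl letters) (∈-upTo⁺ a<n))

words-unique : ∀ k n → Unique (words k n)
words-unique zero    n = [] ∷ []
words-unique (suc k) n = subst Unique (sym (words-suc k n))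
  (UniqueP.cartesianProductWith⁺ prependLetter prependLetter-injective (words-unique k n) (UniqueP.upTo⁺ n))
  where
  prependLetter-injective : ∀ {w x a b} → prependLetter w a ≡ prependLetter x b → w ≡ x × a ≡ b
  prependLetter-injective refl = refl , refl

record IsPerm (n : ℕ) (π : List ℕ) : Set where
  field
    length≡n : length π ≡ n
    letters  : All (Letter n) π
    unique   : Unique π

∈-perms⁻ : ∀ {n π} → π ∈ perms n → IsPerm n π
∈-perms⁻ {n} {π} π∈ =
  let π∈words , distinct = ∈-filter⁻ (T? ∘ distinctᵇ) {xs = words n n} π∈
      len , letters = ∈-words⁻ n n π∈words
  in record { length≡n = len ; letters = letters ; unique = to (T-distinctᵇ π) distinct }

∈-perms⁺ : ∀ {n π} → IsPerm n π → π ∈ perms n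
∈-perms⁺ {n} {π} isPerm =
  ∈-filter⁺ (T? ∘ distinctᵇ) (∈-words⁺ n n π length≡n letters) (from (T-distinctᵇ π) unique)
  where open IsPerm isPerm

perms-unique : ∀ n → Unique (perms n)
perms-unique n = UniqueP.filter⁺ (T? ∘ distinctᵇ) (words-unique n n)

-- Runs, valleys and hooks

runHeads : List ℕ → List ℕ
runHeads π = firsts (runs π)

runs-<-cons : ∀ {x y} zs {r rs} → x < y → runs (y ∷ zs) ≡ r ∷ rs → runs (x ∷ y ∷ zs) ≡ (x ∷ r) ∷ rs
runs-<-cons _ x<y eq rewrite eq | <ᵇ-true x<y = refl

runs-≮-cons : ∀ {x y} zs {r rs} → ¬ x < y → runs (y ∷ zs) ≡ r ∷ rs → runs (x ∷ y ∷ zs) ≡ [ x ] ∷ r ∷ rs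
runs-≮-cons _ x≮y eq rewrite eq | <ᵇ-false x≮y = refl

runs-head : ∀ y zs → ∃₂ λ r rs → runs (y ∷ zs) ≡ (y ∷ r) ∷ rs
runs-head y []       = [] , [] , refl
runs-head y (z ∷ zs) with r , rs , eq ← runs-head z zs | y <? z
... | yes y<z = z ∷ r , rs , runs-<-cons zs y<z eq
... | no  y≮z = [] , (z ∷ r) ∷ rs , runs-≮-cons zs y≮z eq

runHeads-head : ∀ y zs → runHeads (y ∷ zs) ≡ y ∷ drop 1 (runHeads (y ∷ zs))
runHeads-head y zs with r , rs , eq ← runs-head y zs rewrite eq = refl

runHeads-<-cons : ∀ {x y} zs → x < y → runHeads (x ∷ y ∷ zs) ≡ x ∷ drop 1 (runHeads (y ∷ zs))
runHeads-<-cons {x} {y} zs x<y with r , rs , eq ← runs-head y zs rewrite eq | <ᵇ-true x<y = refl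

runHeads-≮-cons : ∀ {x y} zs → ¬ x < y → runHeads (x ∷ y ∷ zs) ≡ x ∷ runHeads (y ∷ zs)
runHeads-≮-cons {x} {y} zs x≮y with r , rs , eq ← runs-head y zs rewrite eq | <ᵇ-false x≮y = refl

val-tail : ∀ x xs → val (x ∷ xs) ≡ 0 → val xs ≡ 0
val-tail x []           _        = refl
val-tail x (y ∷ [])     _        = refl
val-tail x (y ∷ z ∷ zs) noValley = m+n≡0⇒n≡0 _ noValley

valley⇒val≢0 : ∀ {x y z} zs → y < x → y < z → val (x ∷ y ∷ z ∷ zs) ≢ 0
valley⇒val≢0 _ y<x y<z rewrite <ᵇ-true y<x | <ᵇ-true y<z = λ ()

val-<-cons : ∀ {x y} zs → x < y → val (x ∷ y ∷ zs) ≡ val (y ∷ zs)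
val-<-cons []       _   = refl
val-<-cons (z ∷ zs) x<y rewrite <ᵇ-false (<-asym x<y) = refl

val-increasing-∷ʳ : ∀ {xs} u → Increasing xs → val (xs ∷ʳ u) ≡ 0
val-increasing-∷ʳ u []  = refl
val-increasing-∷ʳ u [-] = refl
val-increasing-∷ʳ {x ∷ y ∷ ys} u (x<y ∷ lk) = trans (val-<-cons (ys ∷ʳ u) x<y) (val-increasing-∷ʳ u lk)

data Hook : List ℕ → Set where
  hook : ∀ {x r u} → Increasing (x ∷ r) → x < u → Hook ((x ∷ r) ∷ʳ u)

descent⇒last : ∀ {x y z} zs → z < y → Increasing (x ∷ runHeads (z ∷ zs)) → val (y ∷ z ∷ zs) ≡ 0 →
  zs ≡ [] × x < z
descent⇒last []       _   heads _ = refl , Linked.head heads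
descent⇒last {x} {y} {z} (w ∷ ws) z<y heads noValley with z <? w
... | yes z<w = ⊥-elim (valley⇒val≢0 ws z<y z<w noValley)
... | no  z≮w = ⊥-elim (z≮w (Linked.head (Linked.tail heads′)))
  where
  heads′ : Increasing (x ∷ z ∷ w ∷ drop 1 (runHeads (w ∷ ws)))
  heads′ = subst (λ hs → Increasing (x ∷ hs)) (trans (runHeads-≮-cons ws z≮w) (cong (z ∷_) (runHeads-head w ws))) heads

-- x is the first entry of the word and p the current entry of its first run.
climbFirstRun : ∀ {x p z} zs → x ≤ p → Unique (p ∷ z ∷ zs) → Increasing (x ∷ drop 1 (runHeads (p ∷ z ∷ zs))) →
  val (p ∷ z ∷ zs) ≡ 0 → ∃₂ λ r u → z ∷ zs ≡ r ∷ʳ u × Increasing (p ∷ r) × x < u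
climbFirstRun {x} {p} {z} zs x≤p (p∉ ∷ unique) heads noValley with <-cmp p z
... | tri≈ _ p≡z _ = ⊥-elim (All.head p∉ p≡z)
... | tri> _ _ z<p =
  let zs≡[] , x<z = descent⇒last zs z<p (subst (λ hs → Increasing (x ∷ drop 1 hs)) (runHeads-≮-cons zs (<⇒≯ z<p)) heads) noValley
  in [] , z , cong (z ∷_) zs≡[] , [-] , x<z
... | tri< p<z _ _ with zs
...   | []     = [] , z , refl , [-] , ≤-<-trans x≤p p<z
...   | w ∷ ws =
  let r , u , eq , lk , x<u = climbFirstRun ws (<⇒≤ (≤-<-trans x≤p p<z)) unique
        (subst (λ hs → Increasing (x ∷ drop 1 hs)) (runHeads-<-cons (w ∷ ws) p<z) heads) (val-tail p (z ∷ w ∷ ws) noValley)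
  in z ∷ r , u , cong (z ∷_) eq , p<z ∷ lk , x<u

flattened∧valleyFree⇒Hook : ∀ {π} → 2 ≤ length π → Unique π → Increasing (runHeads π) → val π ≡ 0 → Hook π
flattened∧valleyFree⇒Hook {x ∷ []}     (s≤s ())
flattened∧valleyFree⇒Hook {x ∷ z ∷ zs} _        unique heads noValley =
  let r , u , eq , lk , x<u = climbFirstRun zs ≤-refl unique (subst Increasing (runHeads-head x (z ∷ zs)) heads) noValley
  in subst (λ ys → Hook (x ∷ ys)) (sym eq) (hook lk x<u)

runHeads-increasing-∷ʳ : ∀ {y r} u → Increasing (y ∷ r) →
  runHeads ((y ∷ r) ∷ʳ u) ≡ [ y ] ⊎ runHeads ((y ∷ r) ∷ʳ u) ≡ y ∷ [ u ]
runHeads-increasing-∷ʳ {y} {[]} u [-] with y <? u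
... | yes y<u = inj₁ (runHeads-<-cons [] y<u)
... | no  y≮u = inj₂ (runHeads-≮-cons [] y≮u)
runHeads-increasing-∷ʳ {y} {z ∷ r} u (y<z ∷ lk) = Sum.map extend extend (runHeads-increasing-∷ʳ u lk)
  where
  extend : ∀ {hs} → runHeads ((z ∷ r) ∷ʳ u) ≡ z ∷ hs → runHeads ((y ∷ z ∷ r) ∷ʳ u) ≡ y ∷ hs
  extend eq = trans (runHeads-<-cons (r ∷ʳ u) y<z) (cong (λ hs → y ∷ drop 1 hs) eq)

hook⇒flattened : ∀ {π} → Hook π → Increasing (runHeads π)
hook⇒flattened (hook {x} {r} {u} lk x<u) = Sum.[ (λ eq → subst Increasing (sym eq) [-])
                                               , (λ eq → subst Increasing (sym eq) (x<u ∷ [-])) ]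
                                               (runHeads-increasing-∷ʳ u lk)

hook⇒valleyFree : ∀ {π} → Hook π → val π ≡ 0
hook⇒valleyFree (hook lk _) = val-increasing-∷ʳ _ lk

hookPerm : ℕ → ℕ → List ℕ
hookPerm n u = rangeWithout n u ∷ʳ u

hookPerm-hook : ∀ {n u} → 2 ≤ u → u ≤ n → Hook (hookPerm n u)
hookPerm-hook 2≤u@(s≤s (s≤s _)) u≤n = hook (rangeWithout-increasing (s≤s z≤n) u≤n) 2≤u

hookPerm-isPerm : ∀ {n u} → 1 ≤ u → u ≤ n → IsPerm n (hookPerm n u)
hookPerm-isPerm {n} {u} 1≤u u≤n = record
  { length≡n = begin
      length (rangeWithout n u ∷ʳ u)  ≡⟨ length-++ (rangeWithout n u) ⟩
      length (rangeWithout n u) + 1   ≡⟨ cong (_+ 1) (length-rangeWithout 1≤u u≤n) ⟩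
      n ∸ 1 + 1                       ≡⟨ m∸n+n≡m (≤-trans 1≤u u≤n) ⟩
      n                               ∎
  ; letters  = AllP.∷ʳ⁺ (rangeWithout-letters 1≤u u≤n) (1≤u , u≤n)
  ; unique   = Unique-∷ʳ⁺ (Increasing⇒Unique (rangeWithout-increasing 1≤u u≤n)) (rangeWithout-avoids 1≤u u≤n)
  }
  where open ≡-Reasoning

hookPerm-injective : ∀ n {u v} → hookPerm n u ≡ hookPerm n v → u ≡ v
hookPerm-injective n {u} {v} = ∷ʳ-injectiveʳ (rangeWithout n u) (rangeWithout n v)

isPerm∧Hook⇒≡hookPerm : ∀ {n π} → IsPerm n π → Hook π → ∃ λ u → 2 ≤ u × u ≤ n × π ≡ hookPerm n u
isPerm∧Hook⇒≡hookPerm {n} isPerm (hook {x} {r} {u} lk x<u) =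
  u , 2≤u , u≤n , cong (_∷ʳ u) (increasing⇒≡rangeWithout (≤-trans (s≤s z≤n) 2≤u) u≤n lk xs-letters avoids len)
  where
  open IsPerm isPerm
  xs-letters : All (Letter n) (x ∷ r)
  xs-letters = proj₁ (AllP.∷ʳ⁻ {xs = x ∷ r} letters)
  u≤n : u ≤ n
  u≤n = proj₂ (proj₂ (AllP.∷ʳ⁻ {xs = x ∷ r} letters))
  2≤u : 2 ≤ u
  2≤u = ≤-trans (s≤s (proj₁ (All.head xs-letters))) x<u
  avoids : All (_≢ u) (x ∷ r)
  avoids = Unique-∷ʳ⁻ (x ∷ r) unique
  len : length (x ∷ r) ≡ n ∸ 1
  len = begin
    length (x ∷ r)                ≡⟨ m+n∸n≡m (length (x ∷ r)) 1 ⟨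
    length (x ∷ r) + 1 ∸ 1        ≡⟨ cong (_∸ 1) (length-++ (x ∷ r)) ⟨
    length ((x ∷ r) ∷ʳ u) ∸ 1     ≡⟨ cong (_∸ 1) length≡n ⟩
    n ∸ 1                         ∎
    where open ≡-Reasoning

flatNoValleyᵇ : List ℕ → Bool
flatNoValleyᵇ π = flattenedᵇ π ∧ (val π ≡ᵇ 0)

hookPerms : ℕ → List (List ℕ)
hookPerms n = map (hookPerm n) (range 2 (n ∸ 1))

∈-flatNoValley⇔∈-hookPerms : ∀ {n π} → 2 ≤ n → π ∈ filterᵇ flatNoValleyᵇ (perms n) ⇔ π ∈ hookPerms n
∈-flatNoValley⇔∈-hookPerms {suc k} {π} (s≤s 1≤k) = mk⇔ ⇒ ⇐
  where
  ⇒ : π ∈ filterᵇ flatNoValleyᵇ (perms (suc k)) → π ∈ hookPerms (suc k)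
  ⇒ π∈ =
    let π∈perms , t      = ∈-filter⁻ (T? ∘ flatNoValleyᵇ) {xs = perms (suc k)} π∈
        flat , noValley = to T-∧ t
        isPerm          = ∈-perms⁻ π∈perms
        open IsPerm isPerm
        π-hook = flattened∧valleyFree⇒Hook (subst (2 ≤_) (sym length≡n) (s≤s 1≤k)) unique
                   (to (T-increasingᵇ (runHeads π)) flat) (≡ᵇ⇒≡ (val π) 0 noValley)
        u , 2≤u , u≤n , π≡ = isPerm∧Hook⇒≡hookPerm isPerm π-hook
    in subst (_∈ hookPerms (suc k)) (sym π≡) (∈-map⁺ (hookPerm (suc k)) (∈-range⁺ 2≤u (s≤s u≤n)))
  ⇐ : π ∈ hookPerms (suc k) → π ∈ filterᵇ flatNoValleyᵇ (perms (suc k))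
  ⇐ π∈ =
    let u , u∈ , π≡ = ∈-map⁻ (hookPerm (suc k)) π∈
        2≤u , u<2+k = All.lookup (range-bounds 2 k) u∈
        π-hook       = hookPerm-hook 2≤u (≤-pred u<2+k)
    in subst (_∈ filterᵇ flatNoValleyᵇ (perms (suc k))) (sym π≡)
         (∈-filter⁺ (T? ∘ flatNoValleyᵇ)
           (∈-perms⁺ (hookPerm-isPerm (≤-trans (s≤s z≤n) 2≤u) (≤-pred u<2+k)))
           (from T-∧ (from (T-increasingᵇ _) (hook⇒flattened π-hook) , ≡⇒≡ᵇ _ 0 (hook⇒valleyFree π-hook))))

flatNoValley≡n∸1 : ∀ n → 2 ≤ n → flatNoValley n ≡ n ∸ 1
flatNoValley≡n∸1 n 2≤n = begin
  flatNoValley n            ≡⟨ unique∧set⇒length≡ flatNoValley-unique hookPerms-unique (∈-flatNoValley⇔∈-hookPerms 2≤n) ⟩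
  length (hookPerms n)      ≡⟨ length-map (hookPerm n) (range 2 (n ∸ 1)) ⟩
  length (range 2 (n ∸ 1))  ≡⟨ length-range 2 (n ∸ 1) ⟩
  n ∸ 1                     ∎
  where
  open ≡-Reasoning
  flatNoValley-unique : Unique (filterᵇ flatNoValleyᵇ (perms n))
  flatNoValley-unique = UniqueP.filter⁺ (T? ∘ flatNoValleyᵇ) (perms-unique n)
  hookPerms-unique : Unique (hookPerms n)
  hookPerms-unique = UniqueP.map⁺ (hookPerm-injective n) (Increasing⇒Unique (range-increasing 2 (n ∸ 1)))

-- The exponential generating function

toℚᵘ-/ : ∀ i n .{{_ : NonZero n}} → toℚᵘ (i / n) ℚᵘ.≃ i ℚᵘ./ n
toℚᵘ-/ i (suc n) = ℚ.toℚᵘ-fromℚᵘ (mkℚᵘ i n)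

a/[1+a]d≡1/d-1/[1+a]d : ∀ a d .{{_ : NonZero d}} .{{_ : NonZero (suc a * d)}} →
  (+ a) / (suc a * d) ≡ (+ 1) / d ℚ.- (+ 1) / (suc a * d)
a/[1+a]d≡1/d-1/[1+a]d a (suc d) = ℚ.toℚᵘ-injective (begin
  toℚᵘ (+ a / A)                                   ≈⟨ toℚᵘ-/ (+ a) A ⟩
  + a ℚᵘ./ A                                       ≈⟨ *≡* (cross-multiplied (+ a) (+ suc d)) ⟩
  + 1 ℚᵘ./ suc d ℚᵘ.- + 1 ℚᵘ./ A                    ≈⟨ ℚᵘ.+-cong (toℚᵘ-/ (+ 1) (suc d)) (ℚᵘ.-‿cong (toℚᵘ-/ (+ 1) A)) ⟨
  toℚᵘ (+ 1 / suc d) ℚᵘ.- toℚᵘ (+ 1 / A)            ≈⟨ ℚᵘ.+-congʳ (toℚᵘ (+ 1 / suc d)) (ℚ.toℚᵘ-homo‿- (+ 1 / A)) ⟨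
  toℚᵘ (+ 1 / suc d) ℚᵘ.+ toℚᵘ (- (+ 1 / A))        ≈⟨ ℚ.toℚᵘ-homo-+ (+ 1 / suc d) (- (+ 1 / A)) ⟨
  toℚᵘ (+ 1 / suc d ℚ.- + 1 / A)                   ∎)
  where
  open ℚᵘ.≃-Reasoning
  A : ℕ
  A = suc a * suc d
  cross-multiplied : ∀ a e → let A = (+ 1 ℤ.+ a) ℤ.* e in
    a ℤ.* (e ℤ.* A) ≡ (+ 1 ℤ.* A ℤ.+ ℤ.- (+ 1) ℤ.* e) ℤ.* A
  cross-multiplied = solve-∀

egf-∸1 : ∀ m → egf (_∸ 1) (suc m) ≡ expS m ℚ.- expS (suc m)
egf-∸1 m = a/[1+a]d≡1/d-1/[1+a]d m (m !) {{m !≢0}} {{suc m !≢0}}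

egf-cong : ∀ {a b} n → a n ≡ b n → egf a n ≡ egf b n
egf-cong n = cong (λ k → egf (λ _ → k) n)

[x-1]⊛-suc : ∀ f n → ((X ⊕ const (- 1ℚ)) ⊛ f) (suc n) ≡ f n ℚ.- f (suc n)
[x-1]⊛-suc f n = begin
  ((X ⊕ const (- 1ℚ)) ⊛ f) (suc n)
    ≡⟨ cong (λ s → - 1ℚ ℚ.* f (suc n) ℚ.+ (1ℚ ℚ.* f n ℚ.+ s)) (foldr-+-zeros higher-terms) ⟩
  - 1ℚ ℚ.* f (suc n) ℚ.+ (1ℚ ℚ.* f n ℚ.+ 0ℚ)
    ≡⟨ cong₂ ℚ._+_ (-1*x≈-x (f (suc n))) (trans (ℚ.+-identityʳ _) (ℚ.*-identityˡ (f n))) ⟩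
  - f (suc n) ℚ.+ f n
    ≡⟨ ℚ.+-comm (- f (suc n)) (f n) ⟩
  f n ℚ.- f (suc n) ∎
  where
  open ≡-Reasoning
  higher-terms : All (_≡ 0ℚ) (map (λ k → (X ⊕ const (- 1ℚ)) k ℚ.* f (suc n ∸ k)) (applyUpTo (suc ∘ suc) n))
  higher-terms = AllP.map⁺ (AllP.applyUpTo⁺₂ _ n (λ i → ℚ.*-zeroˡ (f (n ∸ suc i))))
  foldr-+-zeros : ∀ {xs} → All (_≡ 0ℚ) xs → foldr ℚ._+_ 0ℚ xs ≡ 0ℚ
  foldr-+-zeros []           = refl
  foldr-+-zeros (refl ∷ xs≡0) = trans (ℚ.+-identityˡ _) (foldr-+-zeros xs≡0)

egf-flatNoValley : (n : ℕ) → egf flatNoValley n ≡ (const ((+ 2) / 1) ⊕ (X ⊕ ((X ⊕ const (- 1ℚ)) ⊛ expS))) n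
egf-flatNoValley zero          = refl
egf-flatNoValley (suc zero)    = refl
egf-flatNoValley (suc (suc m)) = begin
  egf flatNoValley (2 + m)
    ≡⟨ egf-cong {flatNoValley} {_∸ 1} (2 + m) (flatNoValley≡n∸1 (2 + m) (s≤s (s≤s z≤n))) ⟩
  egf (_∸ 1) (2 + m)
    ≡⟨ egf-∸1 (suc m) ⟩
  expS (suc m) ℚ.- expS (2 + m)
    ≡⟨ [x-1]⊛-suc expS (suc m) ⟨
  ((X ⊕ const (- 1ℚ)) ⊛ expS) (2 + m)
    ≡⟨ trans (ℚ.+-identityˡ _) (ℚ.+-identityˡ _) ⟨
  (const ((+ 2) / 1) ⊕ (X ⊕ ((X ⊕ const (- 1ℚ)) ⊛ expS))) (2 + m) ∎
  where open ≡-Reasoning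

corollary3p3 : ((n : ℕ) → egf flatNoValley n ≡ (const ((+ 2) / 1) ⊕ (X ⊕ ((X ⊕ const (- 1ℚ)) ⊛ expS))) n)
    × ((n : ℕ) → 2 ≤ n → flatNoValley n ≡ n ∸ 1)
corollary3p3 = egf-flatNoValley , flatNoValley≡n∸1
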